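{- Consider a finite graph with disjoint vertex sets $U,V$ such that $V\neq\emptyset$, $|U|=c|V|$ for some $c>0$, and every edge incident to a vertex of $U$ has its other endpoint in $V$ (edges incident to $V$ need not go to $U$). Let $d(v)$ denote the degree of $v$ in this graph, and suppose that for every edge $(u,v)$ of the graph $d(u)+d(v)\le\Delta$, for some positive integer $\Delta$. Then the average degree of the vertices in $U$ is at most $\frac{\Delta}{c+1}$. -}

module Defs where

open import Data.Bool using (Bool; true; false; if_then_else_)
open import Data.Nat using (ℕ)
open import Data.Fin using (Fin)
open import Data.List using (List; map; filter; allFin)
open import Data.Nat.ListAction using (sum)
open import Data.Fin.Subset using (Subset; _∈_)
open import Data.Fin.Subset.Properties using (_∈?_)
open import Data.Integer using (+_)
open import Data.Rational using (ℚ; _/_)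
open import Relation.Binary.PropositionalEquality using (_≡_)

record Graph (n : ℕ) : Set where
  field
    adj       : Fin n → Fin n → Bool
    adj-sym   : ∀ x y → adj x y ≡ adj y x
    adj-irrefl : ∀ x → adj x x ≡ false

open Graph public

deg : ∀ {n} → Graph n → Fin n → ℕ
deg {n} G v = sum (map (λ w → if adj G v w then 1 else 0) (allFin n))

degSum : ∀ {n} → Graph n → Subset n → ℕ
degSum {n} G U = sum (map (deg G) (filter (_∈? U) (allFin n)))

toℚ : ℕ → ℚ
toℚ k = (+ k) / 1

-- Count the edges between U and V twice, weighting each edge uv by d(u) + d(v) ≤ Δ.
-- With D = Σ_{u∈U} d(u) edges and g(v) = number of U-neighbours of v, the weighted
-- count is Σ_U d(u)² + Σ_V g(v) d(v) ≤ Δ D, while Cauchy–Schwarz (with Σ_V g = D)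
-- gives Σ_U d(u)² ≥ D²/|U| and Σ_V g(v) d(v) ≥ Σ_V g(v)² ≥ D²/|V|.  Hence
-- D (|U| + |V|) ≤ Δ |U| |V|, which is the claim after dividing by |V| and using |U| = c|V|.
module Submission where

open import Defs
open import Data.Bool using (true; false; if_then_else_)
open import Data.Nat using (ℕ; zero; suc; _+_; _*_; _≤_; z≤n; s≤s; NonZero)
open import Data.Nat.Properties
open import Data.Nat.Tactic.RingSolver using (solve-∀)
open import Algebra.Properties.CommutativeSemigroup +-commutativeSemigroup using (interchange)
open import Data.Nat.ListAction using (sum)
open import Data.List using (List; []; _∷_; map; filter; length; tabulate; allFin)
open import Data.List.Properties using (map-cong-local; map-tabulate; length-map; filter-≐)
open import Data.List.Relation.Unary.All as All using (All)
open import Data.List.Relation.Unary.All.Properties using (all-filter)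
open import Data.Fin using (Fin)
import Data.Fin as Fin
open import Data.Fin.Subset using (Subset; _∈_; _∉_; ∣_∣; Nonempty; inside; outside)
open import Data.Fin.Subset.Properties using (_∈?_; drop-there; ∣p∣≤∣x∷p∣)
open import Data.Vec using (here; there)
import Data.Vec as Vec
open import Data.Integer using (+≤+)
import Data.Integer as ℤ
import Data.Integer.Properties as ℤ
import Data.Nat.Coprimality as Coprime
open import Data.Rational using (ℚ; mkℚ; 0ℚ; 1ℚ; Positive; *≤*) renaming (_+_ to _+ℚ_; _*_ to _*ℚ_; _≤_ to _≤ℚ_; _<_ to _<ℚ_)
import Data.Rational.Properties as ℚ
open import Data.Product using (_,_)
open import Data.Sum using (inj₁; inj₂)
open import Function using (_∘_; id)
open import Relation.Nullary using (does; yes; no; ¬_; contradiction)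
open import Relation.Unary using (Pred; Decidable)
open import Relation.Binary.PropositionalEquality

private
  variable
    A B : Set
    xs : List A
    f g : A → ℕ

∑ : List A → (A → ℕ) → ℕ
∑ xs f = sum (map f xs)

syntax ∑ xs (λ x → e) = ∑[ x ← xs ] e

∑-cong-local : All (λ x → f x ≡ g x) xs → ∑ xs f ≡ ∑ xs g
∑-cong-local = cong sum ∘ map-cong-local

∑-cong : ∀ (xs : List A) → (∀ x → f x ≡ g x) → ∑ xs f ≡ ∑ xs g
∑-cong xs f≗g = ∑-cong-local (All.tabulate {xs = xs} (λ {x} _ → f≗g x))

∑-mono-≤ : ∀ (xs : List A) → (∀ x → f x ≤ g x) → ∑ xs f ≤ ∑ xs g
∑-mono-≤ []       _   = z≤n
∑-mono-≤ (x ∷ xs) f≤g = +-mono-≤ (f≤g x) (∑-mono-≤ xs f≤g)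

∑-distrib-+ : ∀ (f g : A → ℕ) xs → ∑[ x ← xs ] (f x + g x) ≡ ∑ xs f + ∑ xs g
∑-distrib-+ f g []       = refl
∑-distrib-+ f g (x ∷ xs) =
  trans (cong (f x + g x +_) (∑-distrib-+ f g xs)) (interchange (f x) (g x) (∑ xs f) (∑ xs g))

∑-distribˡ-* : ∀ k (f : A → ℕ) xs → ∑[ x ← xs ] (k * f x) ≡ k * ∑ xs f
∑-distribˡ-* k f []       = sym (*-zeroʳ k)
∑-distribˡ-* k f (x ∷ xs) =
  trans (cong (k * f x +_) (∑-distribˡ-* k f xs)) (sym (*-distribˡ-+ k (f x) (∑ xs f)))

∑-distribʳ-* : ∀ k (f : A → ℕ) xs → ∑[ x ← xs ] (f x * k) ≡ ∑ xs f * k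
∑-distribʳ-* k f xs =
  trans (∑-cong xs (λ x → *-comm (f x) k)) (trans (∑-distribˡ-* k f xs) (*-comm k (∑ xs f)))

∑-const : ∀ k (xs : List A) → ∑[ x ← xs ] k ≡ length xs * k
∑-const k []       = refl
∑-const k (x ∷ xs) = cong (k +_) (∑-const k xs)

∑-comm : ∀ (h : A → B → ℕ) (xs : List A) (ys : List B) →
         ∑[ x ← xs ] ∑[ y ← ys ] h x y ≡ ∑[ y ← ys ] ∑[ x ← xs ] h x y
∑-comm h []       ys = sym (trans (∑-const 0 ys) (*-zeroʳ (length ys)))
∑-comm h (x ∷ xs) ys =
  trans (cong (∑ ys (h x) +_) (∑-comm h xs ys)) (sym (∑-distrib-+ (h x) (λ y → ∑[ x ← xs ] h x y) ys))

∑-filter-≤ : ∀ {p} {P : Pred A p} (P? : Decidable P) (xs : List A) → ∑ (filter P? xs) f ≤ ∑ xs f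
∑-filter-≤ P? [] = z≤n
∑-filter-≤ {f = f} P? (x ∷ xs) with does (P? x)
... | true  = +-monoʳ-≤ (f x) (∑-filter-≤ P? xs)
... | false = ≤-trans (∑-filter-≤ P? xs) (m≤n+m _ (f x))

∑-filter-vanishing : ∀ {p} {P : Pred A p} (P? : Decidable P) (xs : List A) →
                     (∀ x → ¬ P x → f x ≡ 0) → ∑ (filter P? xs) f ≡ ∑ xs f
∑-filter-vanishing P? [] _ = refl
∑-filter-vanishing {f = f} P? (x ∷ xs) f≡0 with P? x
... | yes _  = cong (f x +_) (∑-filter-vanishing P? xs f≡0)
... | no ¬Px = trans (∑-filter-vanishing P? xs f≡0) (cong (_+ ∑ xs f) (sym (f≡0 x ¬Px)))

filter-map : ∀ {p} {P : Pred B p} (P? : Decidable P) (f : A → B) (xs : List A) →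
             filter P? (map f xs) ≡ map f (filter (P? ∘ f) xs)
filter-map P? f []       = refl
filter-map P? f (x ∷ xs) with does (P? (f x))
... | true  = cong (f x ∷_) (filter-map P? f xs)
... | false = filter-map P? f xs

m≤n⇒2*m*n≤m*m+n*n : ∀ {m n} → m ≤ n → 2 * m * n ≤ m * m + n * n
m≤n⇒2*m*n≤m*m+n*n {m} m≤n with k , refl ← m≤n⇒∃[o]m+o≡n m≤n =
  subst (2 * m * (m + k) ≤_) (expand m k) (m≤m+n _ (k * k))
  where
  expand : ∀ m k → 2 * m * (m + k) + k * k ≡ m * m + (m + k) * (m + k)
  expand = solve-∀

2*m*n≤m*m+n*n : ∀ m n → 2 * m * n ≤ m * m + n * n
2*m*n≤m*m+n*n m n with ≤-total m n
... | inj₁ m≤n = m≤n⇒2*m*n≤m*m+n*n m≤n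
... | inj₂ n≤m = subst₂ _≤_ (swap n m) (+-comm (n * n) (m * m)) (m≤n⇒2*m*n≤m*m+n*n n≤m)
  where
  swap : ∀ n m → 2 * n * m ≡ 2 * m * n
  swap = solve-∀

-- Each cross term 2 aᵢ aⱼ of the square is bounded by aᵢ² + aⱼ².
∑-cauchy-schwarz : ∀ (f : A → ℕ) xs → ∑ xs f * ∑ xs f ≤ length xs * ∑[ x ← xs ] (f x * f x)
∑-cauchy-schwarz f []       = z≤n
∑-cauchy-schwarz f (x ∷ xs) = begin
  (a + S) * (a + S)             ≡⟨ square-+ a S ⟩
  a * a + 2 * a * S + S * S     ≤⟨ +-mono-≤ (+-monoʳ-≤ (a * a) cross-terms) (∑-cauchy-schwarz f xs) ⟩
  a * a + (Q + L * (a * a)) + L * Q ≡⟨ regroup (a * a) Q L ⟩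
  suc L * (a * a + Q)           ∎
  where
  open ≤-Reasoning
  a S Q L : ℕ
  a = f x
  S = ∑ xs f
  Q = ∑[ y ← xs ] (f y * f y)
  L = length xs
  cross-terms : 2 * a * S ≤ Q + L * (a * a)
  cross-terms = begin
    2 * a * S                         ≡⟨ sym (∑-distribˡ-* (2 * a) f xs) ⟩
    ∑[ y ← xs ] (2 * a * f y)         ≤⟨ ∑-mono-≤ xs (λ y → 2*m*n≤m*m+n*n a (f y)) ⟩
    ∑[ y ← xs ] (a * a + f y * f y)   ≡⟨ ∑-distrib-+ (λ _ → a * a) (λ y → f y * f y) xs ⟩
    ∑[ y ← xs ] (a * a) + Q           ≡⟨ cong (_+ Q) (∑-const (a * a) xs) ⟩
    L * (a * a) + Q                   ≡⟨ +-comm (L * (a * a)) Q ⟩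
    Q + L * (a * a)                   ∎
  square-+ : ∀ a s → (a + s) * (a + s) ≡ a * a + 2 * a * s + s * s
  square-+ = solve-∀
  regroup : ∀ a² q l → a² + (q + l * a²) + l * q ≡ suc l * (a² + q)
  regroup = solve-∀

-- Over ℚ this reads D²/a + D²/b ≤ q + r ≤ DΔ; clearing denominators leaves a factor D to cancel.
square-bounds⇒*-+-≤ : ∀ D a b q r Δ → D * D ≤ a * q → D * D ≤ b * r → q + r ≤ D * Δ →
                      D * (a + b) ≤ Δ * (a * b)
square-bounds⇒*-+-≤ zero      a b q r Δ _     _     _     = z≤n
square-bounds⇒*-+-≤ D@(suc _) a b q r Δ D²≤aq D²≤br q+r≤DΔ = *-cancelˡ-≤ D (begin
  D * (D * (a + b))          ≡⟨ expand D a b ⟩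
  b * (D * D) + a * (D * D)  ≤⟨ +-mono-≤ (*-monoʳ-≤ b D²≤aq) (*-monoʳ-≤ a D²≤br) ⟩
  b * (a * q) + a * (b * r)  ≡⟨ collect a b q r ⟩
  a * b * (q + r)            ≤⟨ *-monoʳ-≤ (a * b) q+r≤DΔ ⟩
  a * b * (D * Δ)            ≡⟨ reorder a b D Δ ⟩
  D * (Δ * (a * b))          ∎)
  where
  open ≤-Reasoning
  expand : ∀ D a b → D * (D * (a + b)) ≡ b * (D * D) + a * (D * D)
  expand = solve-∀
  collect : ∀ a b q r → b * (a * q) + a * (b * r) ≡ a * b * (q + r)
  collect = solve-∀
  reorder : ∀ a b D Δ → a * b * (D * Δ) ≡ D * (Δ * (a * b))
  reorder = solve-∀

elements : ∀ {n} → Subset n → List (Fin n)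
elements {n} p = filter (_∈? p) (allFin n)

length-elements-∷ : ∀ {n} s (p : Subset n) →
                    length (filter (_∈? s Vec.∷ p) (tabulate Fin.suc)) ≡ length (elements p)
length-elements-∷ {n} s p = begin
  length (filter (_∈? s Vec.∷ p) (tabulate Fin.suc))
    ≡⟨ cong (length ∘ filter (_∈? s Vec.∷ p)) (map-tabulate id Fin.suc) ⟨
  length (filter (_∈? s Vec.∷ p) (map Fin.suc (allFin n)))
    ≡⟨ cong length (filter-map (_∈? s Vec.∷ p) Fin.suc (allFin n)) ⟩
  length (map Fin.suc (filter (λ x → Fin.suc x ∈? s Vec.∷ p) (allFin n)))
    ≡⟨ length-map Fin.suc (filter (λ x → Fin.suc x ∈? s Vec.∷ p) (allFin n)) ⟩
  length (filter (λ x → Fin.suc x ∈? s Vec.∷ p) (allFin n))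
    ≡⟨ cong length (filter-≐ _ (_∈? p) (drop-there , there) (allFin n)) ⟩
  length (elements p)
    ∎
  where open ≡-Reasoning

∣p∣≡length-elements : ∀ {n} (p : Subset n) → ∣ p ∣ ≡ length (elements p)
∣p∣≡length-elements Vec.[]            = refl
∣p∣≡length-elements (inside Vec.∷ p)  =
  cong suc (trans (∣p∣≡length-elements p) (sym (length-elements-∷ inside p)))
∣p∣≡length-elements (outside Vec.∷ p) =
  trans (∣p∣≡length-elements p) (sym (length-elements-∷ outside p))

∑-elements-cong : ∀ {n} {p : Subset n} {f g : Fin n → ℕ} →
                  (∀ {x} → x ∈ p → f x ≡ g x) → ∑ (elements p) f ≡ ∑ (elements p) g
∑-elements-cong {n} {p} f≗g = ∑-cong-local (All.map f≗g (all-filter (_∈? p) (allFin n)))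

x∈p⇒∣p∣≥1 : ∀ {n x} {p : Subset n} → x ∈ p → 1 ≤ ∣ p ∣
x∈p⇒∣p∣≥1 here                      = s≤s z≤n
x∈p⇒∣p∣≥1 {p = s Vec.∷ p} (there x∈p) = ≤-trans (x∈p⇒∣p∣≥1 x∈p) (∣p∣≤∣x∷p∣ s p)

adjacency : ∀ {n} → Graph n → Fin n → Fin n → ℕ
adjacency G x y = if adj G x y then 1 else 0

degIn : ∀ {n} → Graph n → Subset n → Fin n → ℕ
degIn G U y = ∑[ x ← elements U ] adjacency G x y

module _ {n} (G : Graph n) where

  degIn≤deg : ∀ U y → degIn G U y ≤ deg G y
  degIn≤deg U y = begin
    degIn G U y                         ≤⟨ ∑-filter-≤ (_∈? U) (allFin n) ⟩
    ∑[ x ← allFin n ] adjacency G x y   ≡⟨ ∑-cong (allFin n) (λ x → cong (λ b → if b then 1 else 0) (adj-sym G x y)) ⟩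
    deg G y                             ∎
    where open ≤-Reasoning

  adjacency*-mono-≤ : ∀ {Δ} → (∀ x y → adj G x y ≡ true → deg G x + deg G y ≤ Δ) →
                      ∀ x y → adjacency G x y * (deg G x + deg G y) ≤ adjacency G x y * Δ
  adjacency*-mono-≤ bound x y with adj G x y in eq
  ... | false = z≤n
  ... | true  = *-monoʳ-≤ 1 (bound x y eq)

module DoubleCounting {n} (G : Graph n) (U V : Subset n)
                      (U→V : ∀ u w → u ∈ U → adj G u w ≡ true → w ∈ V) where

  a : Fin n → Fin n → ℕ
  a = adjacency G

  Us Vs : List (Fin n)
  Us = elements U
  Vs = elements V

  d dU : Fin n → ℕ
  d  = deg G
  dU = degIn G U

  deg-on-U : ∀ {u} → u ∈ U → d u ≡ ∑[ w ← Vs ] a u w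
  deg-on-U {u} u∈U = sym (∑-filter-vanishing (_∈? V) (allFin n) no-edge)
    where
    no-edge : ∀ w → w ∉ V → a u w ≡ 0
    no-edge w w∉V with adj G u w in eq
    ... | false = refl
    ... | true  = contradiction (U→V u w u∈U eq) w∉V

  degSum≡∑∑adjacency : degSum G U ≡ ∑[ u ← Us ] ∑[ w ← Vs ] a u w
  degSum≡∑∑adjacency = ∑-elements-cong deg-on-U

  degSum≡∑degIn : degSum G U ≡ ∑[ w ← Vs ] dU w
  degSum≡∑degIn = trans degSum≡∑∑adjacency (∑-comm a Us Vs)

  weighted-count : ∑[ u ← Us ] ∑[ w ← Vs ] (a u w * (d u + d w))
                 ≡ ∑[ u ← Us ] (d u * d u) + ∑[ w ← Vs ] (dU w * d w)
  weighted-count = begin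
    ∑[ u ← Us ] ∑[ w ← Vs ] (a u w * (d u + d w))
      ≡⟨ ∑-cong Us (λ u → trans (∑-cong Vs (λ w → *-distribˡ-+ (a u w) (d u) (d w)))
                                (∑-distrib-+ (λ w → a u w * d u) (λ w → a u w * d w) Vs)) ⟩
    ∑[ u ← Us ] (∑[ w ← Vs ] (a u w * d u) + ∑[ w ← Vs ] (a u w * d w))
      ≡⟨ ∑-distrib-+ (λ u → ∑[ w ← Vs ] (a u w * d u)) (λ u → ∑[ w ← Vs ] (a u w * d w)) Us ⟩
    ∑[ u ← Us ] ∑[ w ← Vs ] (a u w * d u) + ∑[ u ← Us ] ∑[ w ← Vs ] (a u w * d w)
      ≡⟨ cong₂ _+_ (∑-cong Us (λ u → ∑-distribʳ-* (d u) (a u) Vs))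
                   (∑-comm (λ u w → a u w * d w) Us Vs) ⟩
    ∑[ u ← Us ] (∑[ w ← Vs ] a u w * d u) + ∑[ w ← Vs ] ∑[ u ← Us ] (a u w * d w)
      ≡⟨ cong₂ _+_ (∑-elements-cong (λ u∈U → cong (_* _) (sym (deg-on-U u∈U))))
                   (∑-cong Vs (λ w → ∑-distribʳ-* (d w) (λ u → a u w) Us)) ⟩
    ∑[ u ← Us ] (d u * d u) + ∑[ w ← Vs ] (dU w * d w)
      ∎
    where open ≡-Reasoning

  weighted-count-≤ : ∀ {Δ} → (∀ x y → adj G x y ≡ true → deg G x + deg G y ≤ Δ) →
                     ∑[ u ← Us ] ∑[ w ← Vs ] (a u w * (d u + d w)) ≤ degSum G U * Δ
  weighted-count-≤ {Δ} bound = begin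
    ∑[ u ← Us ] ∑[ w ← Vs ] (a u w * (d u + d w))
      ≤⟨ ∑-mono-≤ Us (λ u → ∑-mono-≤ Vs (adjacency*-mono-≤ G bound u)) ⟩
    ∑[ u ← Us ] ∑[ w ← Vs ] (a u w * Δ)
      ≡⟨ ∑-cong Us (λ u → ∑-distribʳ-* Δ (a u) Vs) ⟩
    ∑[ u ← Us ] (∑[ w ← Vs ] a u w * Δ)
      ≡⟨ ∑-distribʳ-* Δ (λ u → ∑[ w ← Vs ] a u w) Us ⟩
    (∑[ u ← Us ] ∑[ w ← Vs ] a u w) * Δ
      ≡⟨ cong (_* Δ) degSum≡∑∑adjacency ⟨
    degSum G U * Δ
      ∎
    where open ≤-Reasoning

  squares≤degSum*Δ : ∀ {Δ} → (∀ x y → adj G x y ≡ true → deg G x + deg G y ≤ Δ) →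
                     ∑[ u ← Us ] (d u * d u) + ∑[ w ← Vs ] (dU w * dU w) ≤ degSum G U * Δ
  squares≤degSum*Δ {Δ} bound = begin
    ∑[ u ← Us ] (d u * d u) + ∑[ w ← Vs ] (dU w * dU w)
      ≤⟨ +-monoʳ-≤ _ (∑-mono-≤ Vs (λ w → *-monoʳ-≤ (dU w) (degIn≤deg G U w))) ⟩
    ∑[ u ← Us ] (d u * d u) + ∑[ w ← Vs ] (dU w * d w)
      ≡⟨ weighted-count ⟨
    ∑[ u ← Us ] ∑[ w ← Vs ] (a u w * (d u + d w))
      ≤⟨ weighted-count-≤ bound ⟩
    degSum G U * Δ
      ∎
    where open ≤-Reasoning

  degSum*[∣U∣+∣V∣]≤Δ*[∣U∣*∣V∣] : ∀ {Δ} → (∀ x y → adj G x y ≡ true → deg G x + deg G y ≤ Δ) →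
                                degSum G U * (∣ U ∣ + ∣ V ∣) ≤ Δ * (∣ U ∣ * ∣ V ∣)
  degSum*[∣U∣+∣V∣]≤Δ*[∣U∣*∣V∣] {Δ} bound rewrite ∣p∣≡length-elements U | ∣p∣≡length-elements V =
    square-bounds⇒*-+-≤ (degSum G U) (length Us) (length Vs) Q₁ Q₂ Δ
      (∑-cauchy-schwarz d Us)
      (subst (λ s → s * s ≤ length Vs * Q₂) (sym degSum≡∑degIn) (∑-cauchy-schwarz dU Vs))
      (squares≤degSum*Δ bound)
    where
    Q₁ Q₂ : ℕ
    Q₁ = ∑[ u ← Us ] (d u * d u)
    Q₂ = ∑[ w ← Vs ] (dU w * dU w)

toℚ≡mkℚ : ∀ k → toℚ k ≡ mkℚ (ℤ.+ k) 0 (Coprime.sym (Coprime.1-coprimeTo k))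
toℚ≡mkℚ k = ℚ.normalize-coprime _

toℚ-+ : ∀ m n → toℚ (m + n) ≡ toℚ m +ℚ toℚ n
toℚ-+ m n rewrite toℚ≡mkℚ m | toℚ≡mkℚ n =
  ℚ./-cong {ℤ.+ (m + n)} {1} {ℤ.+ m ℤ.* ℤ.+ 1 ℤ.+ ℤ.+ n ℤ.* ℤ.+ 1}
    (trans (ℤ.pos-+ m n) (sym (cong₂ ℤ._+_ (ℤ.*-identityʳ (ℤ.+ m)) (ℤ.*-identityʳ (ℤ.+ n)))))
    refl

toℚ-* : ∀ m n → toℚ (m * n) ≡ toℚ m *ℚ toℚ n
toℚ-* m n rewrite toℚ≡mkℚ m | toℚ≡mkℚ n =
  ℚ./-cong {ℤ.+ (m * n)} {1} {ℤ.+ m ℤ.* ℤ.+ n} (ℤ.pos-* m n) refl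

toℚ-mono-≤ : ∀ {m n} → m ≤ n → toℚ m ≤ℚ toℚ n
toℚ-mono-≤ {m} {n} m≤n rewrite toℚ≡mkℚ m | toℚ≡mkℚ n =
  *≤* (ℤ.*-monoʳ-≤-nonNeg (ℤ.+ 1) (+≤+ m≤n))

toℚ-suc-positive : ∀ k → Positive (toℚ (suc k))
toℚ-suc-positive k rewrite toℚ≡mkℚ (suc k) = _

*-+-≤⇒average-bound : ∀ D a b Δ (c : ℚ) → 1 ≤ b → toℚ a ≡ c *ℚ toℚ b →
                      D * (a + b) ≤ Δ * (a * b) → toℚ D *ℚ (c +ℚ 1ℚ) ≤ℚ toℚ Δ *ℚ toℚ a
*-+-≤⇒average-bound D a b@(suc k) Δ c _ a≡cb D[a+b]≤Δab =
  ℚ.*-cancelʳ-≤-pos b′ {{toℚ-suc-positive k}} (begin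
    toℚ D *ℚ (c +ℚ 1ℚ) *ℚ b′          ≡⟨ ℚ.*-assoc (toℚ D) (c +ℚ 1ℚ) b′ ⟩
    toℚ D *ℚ ((c +ℚ 1ℚ) *ℚ b′)        ≡⟨ cong (toℚ D *ℚ_) (ℚ.*-distribʳ-+ b′ c 1ℚ) ⟩
    toℚ D *ℚ (c *ℚ b′ +ℚ 1ℚ *ℚ b′)     ≡⟨ cong₂ (λ x y → toℚ D *ℚ (x +ℚ y)) (sym a≡cb) (ℚ.*-identityˡ b′) ⟩
    toℚ D *ℚ (toℚ a +ℚ b′)            ≡⟨ trans (toℚ-* D (a + b)) (cong (toℚ D *ℚ_) (toℚ-+ a b)) ⟨
    toℚ (D * (a + b))                ≤⟨ toℚ-mono-≤ D[a+b]≤Δab ⟩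
    toℚ (Δ * (a * b))                ≡⟨ trans (toℚ-* Δ (a * b)) (cong (toℚ Δ *ℚ_) (toℚ-* a b)) ⟩
    toℚ Δ *ℚ (toℚ a *ℚ b′)            ≡⟨ ℚ.*-assoc (toℚ Δ) (toℚ a) b′ ⟨
    toℚ Δ *ℚ toℚ a *ℚ b′              ∎)
  where
  open ℚ.≤-Reasoning
  b′ : ℚ
  b′ = toℚ b

lemma3 : ∀ {n} (G : Graph n) (U V : Subset n) (c : ℚ) (Δ : ℕ) →
         (∀ x → x ∈ U → x ∉ V) →
         Nonempty V →
         0ℚ <ℚ c →
         toℚ ∣ U ∣ ≡ c *ℚ toℚ ∣ V ∣ →
         (∀ u w → u ∈ U → adj G u w ≡ true → w ∈ V) →
         NonZero Δ →
         (∀ x y → adj G x y ≡ true → deg G x + deg G y ≤ Δ) →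
         toℚ (degSum G U) *ℚ (c +ℚ 1ℚ) ≤ℚ toℚ Δ *ℚ toℚ ∣ U ∣
lemma3 G U V c Δ _ (v , v∈V) _ ∣U∣≡c∣V∣ U→V _ bound =
  *-+-≤⇒average-bound (degSum G U) ∣ U ∣ ∣ V ∣ Δ c (x∈p⇒∣p∣≥1 v∈V) ∣U∣≡c∣V∣
    (DoubleCounting.degSum*[∣U∣+∣V∣]≤Δ*[∣U∣*∣V∣] G U V U→V bound)
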